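{- Assume Banderier's conjecture. Then every primorial $P=p_1p_2\cdots p_k$ (product of the first $k$ primes) such that $P-1$ is not prime belongs to the set $\mathcal{S}$ of positive integers $n$ for which there is no prime $q$ with $n-p^a<q<n$, where $p^a$ is the largest prime power dividing $n$.
   Context: Banderier's conjecture: for every $k$ with $p_1\cdots p_k>2$, if $q$ is the largest prime less than $p_1p_2\cdots p_k$ (where $p_1<p_2<\dots$ are the primes in increasing order), then either $p_1\cdots p_k-q=1$ or $p_1\cdots p_k-q$ is a prime. The largest prime power dividing $n$ means the largest integer of the form $p^a$ ($p$ prime, $a\ge1$) dividing $n$. -}

module Defs where

open import Data.Nat using (ℕ; _*_; _∸_; _^_; _≤_; _<_; _>_)
open import Data.Nat.Divisibility using (_∣_)
open import Data.Nat.Primality using (Prime; prime?)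
open import Data.List using (List; filter; upTo; length)
open import Data.Nat.ListAction using (product)
open import Data.Empty using (⊥)
open import Data.Product using (Σ; ∃; _×_; ∃-syntax)
open import Data.Sum using (_⊎_)
open import Relation.Binary.PropositionalEquality using (_≡_)
open import Relation.Nullary using (¬_)

primesBelow : ℕ → List ℕ
primesBelow n = filter prime? (upTo n)

-- P is the product p₁ p₂ ⋯ p_k of the first k primes:
-- the first k primes are exactly the primes below some bound n
IsPrimorial : ℕ → ℕ → Set
IsPrimorial k P = ∃[ n ] (length (primesBelow n) ≡ k × P ≡ product (primesBelow n))

IsLargestPrimeBelow : ℕ → ℕ → Set
IsLargestPrimeBelow m q = Prime q × q < m × (∀ r → Prime r → q < r → r < m → ⊥)

Banderier : Set
Banderier = ∀ k P → IsPrimorial k P → P > 2 → ∀ q → IsLargestPrimeBelow P q →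
  (P ∸ q ≡ 1) ⊎ Prime (P ∸ q)

IsPrimePowerDivisor : ℕ → ℕ → Set
IsPrimePowerDivisor n d = ∃[ p ] ∃[ a ] (Prime p × 1 ≤ a × d ≡ p ^ a × d ∣ n)

IsLargestPrimePowerDivisor : ℕ → ℕ → Set
IsLargestPrimePowerDivisor n d = IsPrimePowerDivisor n d × (∀ e → IsPrimePowerDivisor n e → e ≤ d)

InS : ℕ → Set
InS n = 0 < n × (∀ d → IsLargestPrimePowerDivisor n d → ∀ q → Prime q → ¬ (n ∸ d < q × q < n))

-- Let P = p₁⋯p_k be the product of the primes below n.  P is squarefree,
-- so every prime power dividing P is a prime p < n; suppose a prime q lies
-- in (P - p, P).  Take the largest prime q₀ < P; then q ≤ q₀, so
-- r = P - q₀ < p.  By Banderier, r = 1 (impossible: q₀ = P - 1 would be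
-- prime) or r is prime.  A prime r < p < n divides P, hence divides
-- q₀ = P - r, so r = q₀ and P = 2q₀.  Then p ∣ 2q₀ forces p ≤ q₀, while
-- q₀ = r < p: contradiction.
module Submission where

open import Defs
open import Data.Nat using (ℕ; zero; suc; _+_; _*_; _∸_; _^_; _≤_; _<_; z≤n; NonZero; >-nonZero; _≟_; nonTrivial⇒≢1; nonTrivial⇒n>1; s≤s⁻¹)
open import Data.Nat.Properties
open import Data.Nat.Divisibility
open import Data.Nat.Primality
open import Data.Nat.Coprimality using (Coprime; coprime-divisor)
open import Data.Nat.ListAction using (product)
open import Data.Nat.ListAction.Properties using (∈⇒∣product)
open import Data.List using ([]; _∷_; upTo)
open import Data.List.Relation.Unary.All using (All; []; _∷_)
import Data.List.Relation.Unary.All as All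
open import Data.List.Relation.Unary.All.Properties using (all-filter)
open import Data.List.Relation.Unary.Any using (here; there)
open import Data.List.Membership.Propositional using (_∈_)
open import Data.List.Membership.Propositional.Properties using (∈-filter⁺; ∈-filter⁻; ∈-upTo⁺; ∈-upTo⁻)
open import Data.List.Relation.Unary.Unique.Propositional using (Unique; _∷_)
import Data.List.Relation.Unary.Unique.Propositional.Properties as Unique
open import Data.Empty using (⊥; ⊥-elim)
open import Data.Product using (Σ; _×_; _,_; proj₁)
open import Data.Sum using (inj₁; inj₂)
open import Relation.Binary.PropositionalEquality
open import Relation.Nullary using (¬_; yes; no)

prime≢1 : ∀ {p} → Prime p → p ≢ 1
prime≢1 (prime _) = nonTrivial⇒≢1

prime>1 : ∀ {p} → Prime p → 1 < p
prime>1 {p} (prime _) = nonTrivial⇒n>1 p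

prime∣prime⇒≡ : ∀ {p q} → Prime p → Prime q → p ∣ q → p ≡ q
prime∣prime⇒≡ pp pq p∣q with prime⇒irreducible pq p∣q
... | inj₁ p≡1 = ⊥-elim (prime≢1 pp p≡1)
... | inj₂ p≡q = p≡q

prime∣double⇒≤ : ∀ {p q} → Prime p → Prime q → p ∣ 2 * q → p ≤ q
prime∣double⇒≤ pp pq p∣2q with euclidsLemma 2 _ pp p∣2q
... | inj₁ p∣2 = ≤-trans (∣⇒≤ p∣2) (prime>1 pq)
... | inj₂ p∣q = ∣⇒≤ {{prime⇒nonZero pq}} p∣q

distinctPrimes⇒coprime : ∀ {p x} → Prime p → Prime x → p ≢ x → Coprime (p * p) x
distinctPrimes⇒coprime {p} pp px p≢x (i∣pp , i∣x) with prime⇒irreducible px i∣x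
... | inj₁ i≡1 = i≡1
... | inj₂ refl with euclidsLemma p p px i∣pp
... | inj₁ x∣p = ⊥-elim (p≢x (sym (prime∣prime⇒≡ px pp x∣p)))
... | inj₂ x∣p = ⊥-elim (p≢x (sym (prime∣prime⇒≡ px pp x∣p)))

prime∣product⇒∈ : ∀ {xs p} → All Prime xs → Prime p → p ∣ product xs → p ∈ xs
prime∣product⇒∈ {[]} [] pp p∣1 = ⊥-elim (prime≢1 pp (∣1⇒≡1 p∣1))
prime∣product⇒∈ {x ∷ xs} (px ∷ ps) pp p∣prod with euclidsLemma x (product xs) pp p∣prod
... | inj₁ p∣x = here (prime∣prime⇒≡ pp px p∣x)
... | inj₂ p∣rest = there (prime∣product⇒∈ ps pp p∣rest)

product-squarefree : ∀ {xs p} → All Prime xs → Unique xs → Prime p → ¬ (p * p ∣ product xs)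
product-squarefree {[]} [] _ pp pp∣1 = prime≢1 pp (∣1⇒≡1 (∣-trans (m∣m*n _) pp∣1))
product-squarefree {x ∷ xs} {p} (px ∷ ps) (x∉xs ∷ u) pp pp∣prod with p ≟ x
... | yes refl = All.lookup x∉xs (prime∣product⇒∈ ps pp (*-cancelˡ-∣ p {{prime⇒nonZero pp}} pp∣prod)) refl
... | no p≢x = product-squarefree ps u pp (coprime-divisor (distinctPrimes⇒coprime pp px p≢x) pp∣prod)

squarefree⇒primePowerDivisor-prime : ∀ {m d} → (∀ {p} → Prime p → ¬ (p * p ∣ m)) →
  IsPrimePowerDivisor m d → Prime d × d ∣ m
squarefree⇒primePowerDivisor-prime sqfree (p , zero , pp , () , _)
squarefree⇒primePowerDivisor-prime sqfree (p , suc zero , pp , _ , refl , d∣m) =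
  subst Prime (sym (*-identityʳ p)) pp , d∣m
squarefree⇒primePowerDivisor-prime sqfree (p , suc (suc b) , pp , _ , refl , d∣m) =
  ⊥-elim (sqfree pp (∣-trans p*p∣p^[2+b] d∣m))
  where
  p*p∣p^[2+b] : p * p ∣ p * (p * p ^ b)
  p*p∣p^[2+b] = subst (p * p ∣_) (*-assoc p p (p ^ b)) (m∣m*n (p ^ b))

largestPrimeBelow : ∀ m {q} → Prime q → q < m → Σ ℕ λ q₀ → IsLargestPrimeBelow m q₀ × q ≤ q₀
largestPrimeBelow (suc m) {q} pq q<1+m with prime? m
... | yes pm = m , (pm , n<1+n m , noneAbove) , s≤s⁻¹ q<1+m
  where
  noneAbove : ∀ r → Prime r → m < r → r < suc m → ⊥
  noneAbove r _ m<r r<1+m = <-irrefl refl (<-≤-trans m<r (s≤s⁻¹ r<1+m))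
... | no ¬pm with largestPrimeBelow m pq (≤∧≢⇒< (s≤s⁻¹ q<1+m) λ q≡m → ¬pm (subst Prime q≡m pq))
... | q₀ , (pq₀ , q₀<m , noneAbove) , q≤q₀ = q₀ , (pq₀ , m<n⇒m<1+n q₀<m , noneAbove′) , q≤q₀
  where
  noneAbove′ : ∀ r → Prime r → q₀ < r → r < suc m → ⊥
  noneAbove′ r pr q₀<r r<1+m with r ≟ m
  ... | yes refl = ¬pm pr
  ... | no r≢m = noneAbove r pr q₀<r (≤∧≢⇒< (s≤s⁻¹ r<1+m) r≢m)

PrimeDownClosed : ℕ → Set
PrimeDownClosed P = ∀ {p r} → Prime p → Prime r → p ∣ P → r < p → r ∣ P

module Primorial (n : ℕ) where

  P : ℕ
  P = product (primesBelow n)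

  allPrime : All Prime (primesBelow n)
  allPrime = all-filter prime? (upTo n)

  squarefree : ∀ {p} → Prime p → ¬ (p * p ∣ P)
  squarefree = product-squarefree allPrime (Unique.filter⁺ prime? (Unique.upTo⁺ n))

  positive : 0 < P
  positive = productOfPrimes≥1 allPrime

  prime<n⇒∣ : ∀ {r} → Prime r → r < n → r ∣ P
  prime<n⇒∣ pr r<n = ∈⇒∣product (∈-filter⁺ prime? (∈-upTo⁺ r<n) pr)

  prime∣⇒<n : ∀ {p} → Prime p → p ∣ P → p < n
  prime∣⇒<n pp p∣P = ∈-upTo⁻ (proj₁ (∈-filter⁻ prime? (prime∣product⇒∈ allPrime pp p∣P)))

  downClosed : PrimeDownClosed P
  downClosed pp pr p∣P r<p = prime<n⇒∣ pr (<-trans r<p (prime∣⇒<n pp p∣P))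

∸-swap-< : ∀ {m n o} → .{{NonZero n}} → n ≤ m → m ∸ n < o → m ∸ o < n
∸-swap-< {m} {n} {o} n≤m m∸n<o = m<n+o⇒m∸n<o m o m<o+n
  where
  open ≤-Reasoning
  m<o+n : m < o + n
  m<o+n = begin-strict
    m           ≡⟨ sym (m+[n∸m]≡n n≤m) ⟩
    n + (m ∸ n) <⟨ +-monoʳ-< n m∸n<o ⟩
    n + o       ≡⟨ +-comm n o ⟩
    o + n       ∎

prime-complement⇒≡ : ∀ {P r q} → Prime r → Prime q → r + q ≡ P → r ∣ P → r ≡ q
prime-complement⇒≡ pr pq r+q≡P r∣P =
  prime∣prime⇒≡ pr pq (∣m+n∣m⇒∣n (subst (_ ∣_) (sym r+q≡P) r∣P) ∣-refl)

primeGap : ∀ {P p q₀} → PrimeDownClosed P → Prime p → p ∣ P → Prime q₀ →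
  P ∸ p < q₀ → q₀ < P → ¬ Prime (P ∸ q₀)
primeGap {P} {p} {q₀} closed pp p∣P pq₀ lo q₀<P pr =
  <-irrefl refl (<-≤-trans q₀<p (prime∣double⇒≤ pp pq₀ p∣2q₀))
  where
  instance
    p≢0 : NonZero p
    p≢0 = prime⇒nonZero pp
  r = P ∸ q₀
  r+q₀≡P : r + q₀ ≡ P
  r+q₀≡P = m∸n+n≡m (<⇒≤ q₀<P)
  r<p : r < p
  r<p = ∸-swap-< (∣⇒≤ {{>-nonZero (≤-<-trans z≤n q₀<P)}} p∣P) lo
  r≡q₀ : r ≡ q₀
  r≡q₀ = prime-complement⇒≡ pr pq₀ r+q₀≡P (closed pp pr p∣P r<p)
  q₀<p : q₀ < p
  q₀<p = subst (_< p) r≡q₀ r<p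
  P≡2q₀ : P ≡ 2 * q₀
  P≡2q₀ = begin
    P           ≡⟨ sym r+q₀≡P ⟩
    r + q₀      ≡⟨ cong (_+ q₀) r≡q₀ ⟩
    q₀ + q₀     ≡⟨ cong (q₀ +_) (sym (+-identityʳ q₀)) ⟩
    2 * q₀      ∎
    where open ≡-Reasoning
  p∣2q₀ : p ∣ 2 * q₀
  p∣2q₀ = subst (p ∣_) P≡2q₀ p∣P

∸≡1⇒≡∸1 : ∀ {P q₀} → q₀ < P → P ∸ q₀ ≡ 1 → P ∸ 1 ≡ q₀
∸≡1⇒≡∸1 {P} q₀<P P∸q₀≡1 = trans (cong (P ∸_) (sym P∸q₀≡1)) (m∸[m∸n]≡n (<⇒≤ q₀<P))

proposition2p7 : Banderier → ∀ k P → IsPrimorial k P → ¬ Prime (P ∸ 1) → InS P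
proposition2p7 banderier k P primorial@(n , _ , refl) P∸1-composite =
  Primorial.positive n , noPrimeInGap
  where
  open Primorial n using (squarefree; downClosed)
  noPrimeInGap : ∀ d → IsLargestPrimePowerDivisor P d → ∀ q → Prime q → ¬ (P ∸ d < q × q < P)
  noPrimeInGap d (d-primePower , _) q pq (lo , q<P)
    with squarefree⇒primePowerDivisor-prime squarefree d-primePower
       | largestPrimeBelow P pq q<P
  ... | pd , d∣P | q₀ , largest@(pq₀ , q₀<P , _) , q≤q₀
    with banderier k P primorial (≤-<-trans (prime>1 pq) q<P) q₀ largest
  ... | inj₁ P∸q₀≡1 = P∸1-composite (subst Prime (sym (∸≡1⇒≡∸1 q₀<P P∸q₀≡1)) pq₀)
  ... | inj₂ P∸q₀-prime =
    primeGap downClosed pd d∣P pq₀ (<-≤-trans lo q≤q₀) q₀<P P∸q₀-prime
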